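{- Let $n\ge 7$ be odd and let $C_2$ be the $(n-1)\times(n-1)$ matrix defined in the context. Let $X$ be the $(n-1)\times(n-1)$ matrix given by $Xe^1=e^1$, $Xe^2=e^2$; for odd $k$ with $3\le k\le n-4$, $Xe^k=-F_{k-2}e^1+\sum_{i=2}^{k-1}(-1)^{i+1}F_{k-i}e^i+e^k$; for even $k$ with $4\le k\le n-3$, $Xe^k=F_{k-2}e^1+\sum_{i=2}^{k-1}(-1)^{i}F_{k-i}e^i+e^k$; $Xe^{n-2}=F_{n-5}e^1+\sum_{i=2}^{n-4}(-1)^iF_{n-3-i}e^i+e^{n-2}$; and $Xe^{n-1}=F_{n-5}e^1+\sum_{i=2}^{n-4}(-1)^iF_{n-3-i}e^i+e^{n-1}$. Then $X=C_2^{ -1}$.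
   Context: $F_m$ is the $m$-th Fibonacci number, $F_1=F_2=1$, $F_{m+1}=F_m+F_{m-1}$. $e^1,\dots,e^{n-1}$ are the standard basis vectors of $\mathbb{R}^{n-1}$. $C_2$ is the $(n-1)\times(n-1)$ matrix with $C_2e^1=e^1$, $C_2e^2=e^2$; for odd $k$ with $3\le k\le n-4$, $C_2e^k=e^1+\sum_{i=1}^{(k-1)/2}e^{2i}+e^k$; for even $k$ with $4\le k\le n-3$, $C_2e^k=\sum_{i=1}^{(k-2)/2}e^{2i+1}+e^k$; $C_2e^{n-2}=\sum_{i=1}^{(n-5)/2}e^{2i+1}+e^{n-2}$ and $C_2e^{n-1}=\sum_{i=1}^{(n-5)/2}e^{2i+1}+e^{n-1}$. -}

module Defs where

open import Data.Nat using (ℕ; zero; suc; _∸_; _≡ᵇ_; _≤ᵇ_; _%_)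
open import Data.Bool using (Bool; true; false; if_then_else_; _∧_; _∨_; not)
open import Data.Integer using (ℤ; +_; -_; _+_; _*_)
open import Data.Fin using (Fin; toℕ)
open import Data.Product using (_×_; ∃)
open import Relation.Binary.PropositionalEquality using (_≡_)

-- Fibonacci numbers, F 1 = F 2 = 1 (F 0 = 0; never used by the matrices below)
F : ℕ → ℕ
F zero = zero
F (suc zero) = suc zero
F (suc (suc m)) = F (suc m) Data.Nat.+ F m

Matrix : ℕ → Set
Matrix m = Fin m → Fin m → ℤ

Σ : (m : ℕ) → (Fin m → ℤ) → ℤ
Σ zero f = + 0
Σ (suc m) f = f Data.Fin.zero + Σ m (λ j → f (Data.Fin.suc j))

_⊗_ : {m : ℕ} → Matrix m → Matrix m → Matrix m
_⊗_ {m} A B i k = Σ m (λ j → A i j * B j k)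

I : (m : ℕ) → Matrix m
I m i k = if toℕ i ≡ᵇ toℕ k then + 1 else + 0

isOdd isEven : ℕ → Bool
isOdd k = k % 2 ≡ᵇ 1
isEven k = k % 2 ≡ᵇ 0

inRange : ℕ → ℕ → ℕ → Bool
inRange a b x = (a ≤ᵇ x) ∧ (x ≤ᵇ b)

b2z : Bool → ℤ
b2z true = + 1
b2z false = + 0

sgn : ℕ → ℤ
sgn i = if isEven i then + 1 else - (+ 1)

-- Entry (row i, column k) of C₂ with 1-based indices i k ∈ {1,…,n-1}:
-- the i-th coordinate of C₂ e^k as given in the paper.
C2entry : ℕ → ℕ → ℕ → ℤ
C2entry n i k =
  if k ≡ᵇ 1 then b2z (i ≡ᵇ 1)
  else if k ≡ᵇ 2 then b2z (i ≡ᵇ 2)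
  else if isOdd k ∧ inRange 3 (n ∸ 4) k then
    b2z ((i ≡ᵇ 1) ∨ (isEven i ∧ inRange 2 (k ∸ 1) i) ∨ (i ≡ᵇ k))
  else if isEven k ∧ inRange 4 (n ∸ 3) k then
    b2z ((isOdd i ∧ inRange 3 (k ∸ 1) i) ∨ (i ≡ᵇ k))
  else if (k ≡ᵇ n ∸ 2) ∨ (k ≡ᵇ n ∸ 1) then
    b2z ((isOdd i ∧ inRange 3 (n ∸ 4) i) ∨ (i ≡ᵇ k))
  else + 0

Xentry : ℕ → ℕ → ℕ → ℤ
Xentry n i k =
  if k ≡ᵇ 1 then b2z (i ≡ᵇ 1)
  else if k ≡ᵇ 2 then b2z (i ≡ᵇ 2)
  else if isOdd k ∧ inRange 3 (n ∸ 4) k then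
    (if i ≡ᵇ 1 then - (+ F (k ∸ 2))
     else if inRange 2 (k ∸ 1) i then sgn (suc i) * + F (k ∸ i)
     else b2z (i ≡ᵇ k))
  else if isEven k ∧ inRange 4 (n ∸ 3) k then
    (if i ≡ᵇ 1 then + F (k ∸ 2)
     else if inRange 2 (k ∸ 1) i then sgn i * + F (k ∸ i)
     else b2z (i ≡ᵇ k))
  else if (k ≡ᵇ n ∸ 2) ∨ (k ≡ᵇ n ∸ 1) then
    (if i ≡ᵇ 1 then + F (n ∸ 5)
     else if inRange 2 (n ∸ 4) i then sgn i * + F (n ∸ 3 ∸ i)
     else b2z (i ≡ᵇ k))
  else + 0

C₂ : (n : ℕ) → Matrix (n ∸ 1)
C₂ n i k = C2entry n (suc (toℕ i)) (suc (toℕ k))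

X : (n : ℕ) → Matrix (n ∸ 1)
X n i k = Xentry n (suc (toℕ i)) (suc (toℕ k))

IsInverseOf : {m : ℕ} → Matrix m → Matrix m → Set
IsInverseOf {m} B A = (∀ i k → (A ⊗ B) i k ≡ I m i k) × (∀ i k → (B ⊗ A) i k ≡ I m i k)

-- The columns c₁, …, c_{n-1} of C₂ satisfy c_{k+2} = c_k - e^k + e^{k+1} + e^{k+2} for 2 ≤ k ≤ n - 5,
-- and c_{n-2}, c_{n-1} are c_{n-3} with its diagonal entry e^{n-3} moved to e^{n-2}, e^{n-1}.  The columns x_k
-- of X satisfy x_{k+2} = x_k - e^k + e^{k+2} - x_{k+1} for 2 ≤ k ≤ n - 5, which is the Fibonacci recurrence
-- with alternating signs, and the same move of the diagonal entry for the last two columns.  Applying X to the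
-- recurrence of C₂ and then using the recurrence of X turns X c_k = e^k into X c_{k+2} = e^{k+2}; together with
-- X c₁ = e¹, X c₂ = e², X c₃ = e³ this gives X C₂ = I by induction on k.  Finally C₂ is upper unitriangular,
-- so right multiplication by C₂ is injective, and (C₂ X) C₂ = C₂ (X C₂) = C₂ = I C₂ forces C₂ X = I.

module Submission where

open import Defs
open import Data.Nat using (ℕ; _≤_; _+_; _*_)
open import Data.Product using (∃)
open import Relation.Binary.PropositionalEquality using (_≡_)

open import Data.Nat using (zero; suc; _∸_; _<_; _≡ᵇ_; _≤ᵇ_; z≤n; s≤s; ≤‴-refl; ≤‴-step)
open import Relation.Binary.Definitions using (tri<; tri≈; tri>)
import Data.Nat.Properties as ℕₚ
open import Data.Bool using (true; false; T; not; if_then_else_; _∧_; _∨_)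
open import Data.Bool.Properties using (T-≡; T-∧; ¬-not; ∧-zeroʳ; ∧-identityʳ; ∨-zeroʳ; ∨-identityʳ)
open import Function.Bundles using (Equivalence)
open import Data.Fin using (Fin; toℕ)
import Data.Fin.Properties as FP
open import Data.Integer as ℤ using (ℤ; +_; -_)
open import Data.Integer.Tactic.RingSolver using (solve-∀)
import Data.Nat.Tactic.RingSolver as ℕ-Solver
import Data.Integer.Properties as ℤₚ
open import Algebra.Properties.Semiring.Sum ℤₚ.+-*-semiring
  using (sum; sum-cong-≗; ∑-distrib-+; ∑-comm; *-distribˡ-sum; *-distribʳ-sum)
open import Algebra.Properties.AbelianGroup ℤₚ.+-0-abelianGroup using (∙-cancelˡ; ∙-cancelʳ)
open import Data.Product using (_×_; _,_; proj₂)
open import Data.Sum using (inj₁; inj₂)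
open import Relation.Binary.PropositionalEquality using (_≢_; refl; sym; trans; cong; cong₂; subst; module ≡-Reasoning)

-- Sums and products of integer matrices

Σ≡sum : ∀ m (f : Fin m → ℤ) → Σ m f ≡ sum f
Σ≡sum zero    f = refl
Σ≡sum (suc m) f = cong (ℤ._+_ (f Fin.zero)) (Σ≡sum m (λ j → f (Fin.suc j)))

Σ-cong : ∀ m {f g : Fin m → ℤ} → (∀ j → f j ≡ g j) → Σ m f ≡ Σ m g
Σ-cong m {f} {g} f≗g = trans (Σ≡sum m f) (trans (sum-cong-≗ f≗g) (sym (Σ≡sum m g)))

Σ-distrib-+ : ∀ m (f g : Fin m → ℤ) → Σ m (λ j → f j ℤ.+ g j) ≡ Σ m f ℤ.+ Σ m g
Σ-distrib-+ m f g = trans (Σ≡sum m _) (trans (∑-distrib-+ f g) (sym (cong₂ ℤ._+_ (Σ≡sum m f) (Σ≡sum m g))))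

Σ-zero : ∀ m {f : Fin m → ℤ} → (∀ j → f j ≡ + 0) → Σ m f ≡ + 0
Σ-zero zero    f≡0 = refl
Σ-zero (suc m) f≡0 = cong₂ ℤ._+_ (f≡0 Fin.zero) (Σ-zero m (λ j → f≡0 (Fin.suc j)))

Σ-comm : ∀ m (f : Fin m → Fin m → ℤ) → Σ m (λ j → Σ m (f j)) ≡ Σ m (λ l → Σ m (λ j → f j l))
Σ-comm m f = trans (Σ²≡sum² f) (trans (∑-comm f) (sym (Σ²≡sum² (λ l j → f j l))))
  where
  Σ²≡sum² : (g : Fin m → Fin m → ℤ) → Σ m (λ j → Σ m (g j)) ≡ sum (λ j → sum (g j))
  Σ²≡sum² g = trans (Σ-cong m (λ j → Σ≡sum m (g j))) (Σ≡sum m _)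

*-distribˡ-Σ : ∀ m x (f : Fin m → ℤ) → x ℤ.* Σ m f ≡ Σ m (λ j → x ℤ.* f j)
*-distribˡ-Σ m x f = trans (cong (x ℤ.*_) (Σ≡sum m f)) (trans (*-distribˡ-sum x f) (sym (Σ≡sum m _)))

*-distribʳ-Σ : ∀ m x (f : Fin m → ℤ) → Σ m f ℤ.* x ≡ Σ m (λ j → f j ℤ.* x)
*-distribʳ-Σ m x f = trans (cong (ℤ._* x) (Σ≡sum m f)) (trans (*-distribʳ-sum x f) (sym (Σ≡sum m _)))

_⊙_ : ∀ {m} → (Fin m → ℤ) → Matrix m → Fin m → ℤ
_⊙_ {m} r A k = Σ m (λ j → r j ℤ.* A j k)

⊗-assoc : ∀ {m} (A B C : Matrix m) i k → ((A ⊗ B) ⊗ C) i k ≡ (A ⊗ (B ⊗ C)) i k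
⊗-assoc {m} A B C i k = begin
  Σ m (λ l → Σ m (λ j → A i j ℤ.* B j l) ℤ.* C l k)    ≡⟨ Σ-cong m (λ l → *-distribʳ-Σ m (C l k) _) ⟩
  Σ m (λ l → Σ m (λ j → A i j ℤ.* B j l ℤ.* C l k))    ≡⟨ Σ-comm m (λ l j → A i j ℤ.* B j l ℤ.* C l k) ⟩
  Σ m (λ j → Σ m (λ l → A i j ℤ.* B j l ℤ.* C l k))
    ≡⟨ Σ-cong m (λ j → Σ-cong m (λ l → ℤₚ.*-assoc (A i j) _ _)) ⟩
  Σ m (λ j → Σ m (λ l → A i j ℤ.* (B j l ℤ.* C l k)))  ≡⟨ Σ-cong m (λ j → sym (*-distribˡ-Σ m (A i j) _)) ⟩
  Σ m (λ j → A i j ℤ.* Σ m (λ l → B j l ℤ.* C l k))    ∎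
  where open ≡-Reasoning

⊙-identityʳ : ∀ {m} (r : Fin m → ℤ) k → (r ⊙ I m) k ≡ r k
⊙-identityʳ {suc m} r Fin.zero = begin
  r Fin.zero ℤ.* + 1 ℤ.+ Σ m (λ j → r (Fin.suc j) ℤ.* + 0)
    ≡⟨ cong₂ ℤ._+_ (ℤₚ.*-identityʳ (r Fin.zero)) (Σ-zero m (λ j → ℤₚ.*-zeroʳ (r (Fin.suc j)))) ⟩
  r Fin.zero ℤ.+ + 0                                     ≡⟨ ℤₚ.+-identityʳ _ ⟩
  r Fin.zero                                             ∎
  where open ≡-Reasoning
⊙-identityʳ {suc m} r (Fin.suc k) =
  trans (cong (ℤ._+ Σ m (λ j → r (Fin.suc j) ℤ.* I m j k)) (ℤₚ.*-zeroʳ (r Fin.zero)))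
  (trans (ℤₚ.+-identityˡ _) (⊙-identityʳ {m} (λ j → r (Fin.suc j)) k))

⊗-identityˡ : ∀ {m} (A : Matrix m) i k → (I m ⊗ A) i k ≡ A i k
⊗-identityˡ {m} A i k = I-selects (λ j → A j k) i
  where
  I-selects : ∀ {m} (f : Fin m → ℤ) i → Σ m (λ j → I m i j ℤ.* f j) ≡ f i
  I-selects {suc m} f Fin.zero = begin
    + 1 ℤ.* f Fin.zero ℤ.+ Σ m (λ j → + 0 ℤ.* f (Fin.suc j))
      ≡⟨ cong₂ ℤ._+_ (ℤₚ.*-identityˡ (f Fin.zero)) (Σ-zero m (λ j → ℤₚ.*-zeroˡ (f (Fin.suc j)))) ⟩
    f Fin.zero ℤ.+ + 0                                        ≡⟨ ℤₚ.+-identityʳ _ ⟩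
    f Fin.zero                                                ∎
    where open ≡-Reasoning
  I-selects {suc m} f (Fin.suc i) =
    trans (cong (ℤ._+ Σ m (λ j → I m i j ℤ.* f (Fin.suc j))) (ℤₚ.*-zeroˡ (f Fin.zero)))
      (trans (ℤₚ.+-identityˡ _) (I-selects {m} (λ j → f (Fin.suc j)) i))

IsUpperUnitriangular : ∀ {m} → Matrix m → Set
IsUpperUnitriangular U = (∀ k → U k k ≡ + 1) × (∀ j k → toℕ k < toℕ j → U j k ≡ + 0)

⊙-cancelʳ-unitriangular : ∀ {m} {U : Matrix m} → IsUpperUnitriangular U →
                          ∀ {r s} → (∀ k → (r ⊙ U) k ≡ (s ⊙ U) k) → ∀ j → r j ≡ s j
⊙-cancelʳ-unitriangular {suc m} {U} (diagonal , below) {r} {s} rU≡sU = r≡s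
  where
  first-column : ∀ t → (t ⊙ U) Fin.zero ≡ t Fin.zero
  first-column t = begin
    t Fin.zero ℤ.* U Fin.zero Fin.zero ℤ.+ Σ m (λ j → t (Fin.suc j) ℤ.* U (Fin.suc j) Fin.zero)
      ≡⟨ cong₂ ℤ._+_ (cong (t Fin.zero ℤ.*_) (diagonal Fin.zero)) (Σ-zero m below-diagonal) ⟩
    t Fin.zero ℤ.* + 1 ℤ.+ + 0   ≡⟨ trans (ℤₚ.+-identityʳ _) (ℤₚ.*-identityʳ _) ⟩
    t Fin.zero                   ∎
    where
    open ≡-Reasoning
    below-diagonal : ∀ j → t (Fin.suc j) ℤ.* U (Fin.suc j) Fin.zero ≡ + 0
    below-diagonal j = trans (cong (t (Fin.suc j) ℤ.*_) (below (Fin.suc j) Fin.zero (s≤s z≤n))) (ℤₚ.*-zeroʳ (t (Fin.suc j)))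
  r₀≡s₀ : r Fin.zero ≡ s Fin.zero
  r₀≡s₀ = trans (sym (first-column r)) (trans (rU≡sU Fin.zero) (first-column s))
  U′ : Matrix m
  U′ j k = U (Fin.suc j) (Fin.suc k)
  rU′≡sU′ : ∀ k → ((λ j → r (Fin.suc j)) ⊙ U′) k ≡ ((λ j → s (Fin.suc j)) ⊙ U′) k
  rU′≡sU′ k = ∙-cancelˡ (r Fin.zero ℤ.* U Fin.zero (Fin.suc k)) _ _
    (trans (rU≡sU (Fin.suc k)) (cong (λ x → x ℤ.* U Fin.zero (Fin.suc k) ℤ.+ _) (sym r₀≡s₀)))
  U′-unitriangular : IsUpperUnitriangular U′
  U′-unitriangular = (λ k → diagonal (Fin.suc k)) , (λ j k k<j → below (Fin.suc j) (Fin.suc k) (s≤s k<j))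
  r≡s : ∀ j → r j ≡ s j
  r≡s Fin.zero    = r₀≡s₀
  r≡s (Fin.suc j) = ⊙-cancelʳ-unitriangular U′-unitriangular {λ j → r (Fin.suc j)} {λ j → s (Fin.suc j)} rU′≡sU′ j

unitriangular-left-inverse⇒right-inverse : ∀ {m} {C Y : Matrix m} → IsUpperUnitriangular C →
  (∀ i k → (Y ⊗ C) i k ≡ I m i k) → ∀ i k → (C ⊗ Y) i k ≡ I m i k
unitriangular-left-inverse⇒right-inverse {m} {C} {Y} C-unitriangular YC≡I i =
  ⊙-cancelʳ-unitriangular C-unitriangular λ k → begin
    ((C ⊗ Y) ⊗ C) i k  ≡⟨ ⊗-assoc C Y C i k ⟩
    (C ⊗ (Y ⊗ C)) i k  ≡⟨ Σ-cong m (λ j → cong (C i j ℤ.*_) (YC≡I j k)) ⟩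
    (C i ⊙ I m) k      ≡⟨ ⊙-identityʳ (C i) k ⟩
    C i k              ≡⟨ ⊗-identityˡ C i k ⟨
    (I m ⊗ C) i k      ∎
  where open ≡-Reasoning

≡ᵇ-refl : ∀ m → (m ≡ᵇ m) ≡ true
≡ᵇ-refl m = Equivalence.to T-≡ (ℕₚ.≡⇒≡ᵇ m m refl)

≢⇒≡ᵇ≡false : ∀ {m n} → m ≢ n → (m ≡ᵇ n) ≡ false
≢⇒≡ᵇ≡false {m} {n} m≢n = ¬-not (λ m≡ᵇn → m≢n (ℕₚ.≡ᵇ⇒≡ m n (Equivalence.from T-≡ m≡ᵇn)))

≤⇒≤ᵇ≡true : ∀ {m n} → m ≤ n → (m ≤ᵇ n) ≡ true
≤⇒≤ᵇ≡true m≤n = Equivalence.to T-≡ (ℕₚ.≤⇒≤ᵇ m≤n)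

>⇒≤ᵇ≡false : ∀ {m n} → n < m → (m ≤ᵇ n) ≡ false
>⇒≤ᵇ≡false {m} {n} n<m = ¬-not (λ m≤ᵇn → ℕₚ.<⇒≱ n<m (ℕₚ.≤ᵇ⇒≤ m n (Equivalence.from T-≡ m≤ᵇn)))

inRange-true : ∀ {a b x} → a ≤ x → x ≤ b → inRange a b x ≡ true
inRange-true a≤x x≤b = cong₂ _∧_ (≤⇒≤ᵇ≡true a≤x) (≤⇒≤ᵇ≡true x≤b)

inRange-false : ∀ {a b x} → b < x → inRange a b x ≡ false
inRange-false {a} {b} {x} b<x = trans (cong ((a ≤ᵇ x) ∧_) (>⇒≤ᵇ≡false b<x)) (∧-zeroʳ (a ≤ᵇ x))

inRange⇒≤ : ∀ {a b x} → T (inRange a b x) → x ≤ b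
inRange⇒≤ {a} {b} {x} a≤x≤b = ℕₚ.≤ᵇ⇒≤ x b (proj₂ (Equivalence.to T-∧ a≤x≤b))

∧-inRange-above : ∀ b {lo hi x} → hi < x → (b ∧ inRange lo hi x) ≡ false
∧-inRange-above b {lo} hi<x = trans (cong (b ∧_) (inRange-false {lo} hi<x)) (∧-zeroʳ b)

n<2+n : ∀ n → n < 2 + n
n<2+n n = ℕₚ.m<n⇒m<1+n (ℕₚ.n<1+n n)

δ : ℕ → ℕ → ℤ
δ i k = b2z (i ≡ᵇ k)

δ-diagonal : ∀ i → δ i i ≡ + 1
δ-diagonal i = cong b2z (≡ᵇ-refl i)

δ-≢ : ∀ {i k} → i ≢ k → δ i k ≡ + 0
δ-≢ i≢k = cong b2z (≢⇒≡ᵇ≡false i≢k)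

b2z≡if : ∀ b → b2z b ≡ (if b then + 1 else + 0)
b2z≡if true  = refl
b2z≡if false = refl

δ-< : ∀ {i k} → i < k → δ i k ≡ + 0
δ-< i<k = δ-≢ (ℕₚ.<⇒≢ i<k)

δ-> : ∀ {i k} → k < i → δ i k ≡ + 0
δ-> k<i = δ-≢ (ℕₚ.>⇒≢ k<i)

δ-<-both : ∀ {i a d} → i < a → a ≤ d → δ i a ≡ δ i d
δ-<-both i<a a≤d = trans (δ-< i<a) (sym (δ-< (ℕₚ.<-≤-trans i<a a≤d)))

-- Unlike 2 * s, double (suc s) reduces to suc (suc (double s)), so the index tests of Defs compute on 3 + double s.
double : ℕ → ℕ
double zero    = zero
double (suc s) = suc (suc (double s))

double≡2* : ∀ s → double s ≡ 2 * s
double≡2* zero    = refl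
double≡2* (suc s) = trans (cong (_+_ 2) (double≡2* s)) (sym (ℕₚ.*-distribˡ-+ 2 1 s))

double-mono-≤ : ∀ {s t} → s ≤ t → double s ≤ double t
double-mono-≤ z≤n       = z≤n
double-mono-≤ (s≤s s≤t) = s≤s (s≤s (double-mono-≤ s≤t))

double-cancel-≤ : ∀ s t → double s ≤ suc (double t) → s ≤ t
double-cancel-≤ zero    t       _                 = z≤n
double-cancel-≤ (suc s) zero    (s≤s ())
double-cancel-≤ (suc s) (suc t) (s≤s (s≤s ds≤dt)) = s≤s (double-cancel-≤ s t ds≤dt)

data Parity : ℕ → Set where
  even : ∀ s → Parity (double s)
  odd  : ∀ s → Parity (suc (double s))

parity : ∀ c → Parity c
parity zero       = even zero
parity (suc zero) = odd zero
parity (suc (suc c)) with parity c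
... | even s = even (suc s)
... | odd s  = odd (suc s)

isEven-suc : ∀ k → isEven (suc k) ≡ not (isEven k)
isEven-suc zero          = refl
isEven-suc (suc zero)    = refl
isEven-suc (suc (suc k)) = isEven-suc k

isOdd-suc : ∀ k → isOdd (suc k) ≡ not (isOdd k)
isOdd-suc zero          = refl
isOdd-suc (suc zero)    = refl
isOdd-suc (suc (suc k)) = isOdd-suc k

isEven-double : ∀ s → isEven (double s) ≡ true
isEven-double zero    = refl
isEven-double (suc s) = isEven-double s

isOdd-double : ∀ s → isOdd (double s) ≡ false
isOdd-double zero    = refl
isOdd-double (suc s) = isOdd-double s

isEven-suc-double : ∀ s → isEven (suc (double s)) ≡ false
isEven-suc-double s = trans (isEven-suc (double s)) (cong not (isEven-double s))

isOdd-suc-double : ∀ s → isOdd (suc (double s)) ≡ true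
isOdd-suc-double s = trans (isOdd-suc (double s)) (cong not (isOdd-double s))

sgn-suc : ∀ i → sgn (suc i) ≡ - sgn i
sgn-suc zero          = refl
sgn-suc (suc zero)    = refl
sgn-suc (suc (suc i)) = sgn-suc i

sgn-+-even : ∀ a {i} → isEven a ≡ true → sgn (a + i) ≡ sgn i
sgn-+-even zero          _      = refl
sgn-+-even (suc zero)    ()
sgn-+-even (suc (suc a)) a-even = sgn-+-even a a-even

sgn-+-odd : ∀ a {i} → isEven a ≡ false → sgn (a + i) ≡ - sgn i
sgn-+-odd zero          ()
sgn-+-odd (suc zero)    {i} _ = sgn-suc i
sgn-+-odd (suc (suc a)) a-odd = sgn-+-odd a a-odd

sgn-double : ∀ k → sgn (k + k) ≡ + 1
sgn-double zero    = refl
sgn-double (suc k) = trans (cong (λ x → sgn (suc x)) (ℕₚ.+-suc k k)) (sgn-double k)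

-- The shapes of the columns of C₂ and X

-- oddColumn k, evenColumn a a and fibColumn a a are the columns C₂e^k (k odd), C₂e^a (a even) and Xe^a of Defs.
-- The last two columns k = n - 2, n - 1 of C₂ and X are evenColumn (n - 3) k and fibColumn (n - 3) k: column n - 3
-- with its diagonal entry moved to row k.  In fibColumn, sgn (a + i) is (-1)^(i+1) for odd a and (-1)^i for even a.
oddColumn : ℕ → ℕ → ℤ
oddColumn k j = b2z ((j ≡ᵇ 1) ∨ (isEven j ∧ inRange 2 (k ∸ 1) j) ∨ (j ≡ᵇ k))

evenColumn : ℕ → ℕ → ℕ → ℤ
evenColumn a d j = b2z ((isOdd j ∧ inRange 3 (a ∸ 1) j) ∨ (j ≡ᵇ d))

fibColumn : ℕ → ℕ → ℕ → ℤ
fibColumn a d i =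
  if i ≡ᵇ 1 then sgn a ℤ.* + F (a ∸ 2)
  else if inRange 2 (a ∸ 1) i then sgn (a + i) ℤ.* + F (a ∸ i)
  else δ i d

oddColumn-inside : ∀ {k j} → 2 ≤ j → j < k → oddColumn k j ≡ b2z (isEven j)
oddColumn-inside {suc k} {j@(suc (suc _))} 2≤j j<k
  rewrite inRange-true 2≤j (ℕₚ.≤-pred j<k) | ≢⇒≡ᵇ≡false (ℕₚ.<⇒≢ j<k) =
  cong b2z (trans (∨-identityʳ _) (∧-identityʳ _))
oddColumn-inside {suc k} {suc zero} (s≤s ()) _

oddColumn-diagonal : ∀ k → oddColumn k k ≡ + 1
oddColumn-diagonal k rewrite ≡ᵇ-refl k = cong b2z (trans (cong ((k ≡ᵇ 1) ∨_) (∨-zeroʳ _)) (∨-zeroʳ _))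

oddColumn-beyond : ∀ {k j} → 1 ≤ k → k < j → oddColumn k j ≡ + 0
oddColumn-beyond {suc k} {suc (suc _)} _ k<j
  rewrite inRange-false {2} (ℕₚ.≤-<-trans (ℕₚ.m∸n≤m (suc k) 1) k<j) | ≢⇒≡ᵇ≡false (ℕₚ.>⇒≢ k<j) =
  cong b2z (trans (∨-identityʳ _) (∧-zeroʳ _))
oddColumn-beyond {suc zero} {suc zero} _ (s≤s ())
oddColumn-beyond {suc (suc _)} {suc zero} _ (s≤s ())

evenColumn-inside : ∀ {a d j} → 2 ≤ j → j < a → a ≤ d → evenColumn a d j ≡ b2z (isOdd j)
evenColumn-inside {a} {d} {2} _ 2<a a≤d = δ-< (ℕₚ.<-≤-trans 2<a a≤d)
evenColumn-inside {suc a} {d} {j@(suc (suc (suc _)))} _ j<a a≤d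
  rewrite inRange-true (s≤s (s≤s (s≤s z≤n))) (ℕₚ.≤-pred j<a)
        | ≢⇒≡ᵇ≡false (ℕₚ.<⇒≢ (ℕₚ.<-≤-trans j<a a≤d)) =
  cong b2z (trans (∨-identityʳ _) (∧-identityʳ _))
evenColumn-inside {j = suc zero} (s≤s ()) _ _

evenColumn-diagonal : ∀ a d → evenColumn a d d ≡ + 1
evenColumn-diagonal a d rewrite ≡ᵇ-refl d = cong b2z (∨-zeroʳ _)

evenColumn-beyond : ∀ {a d j} → a ≤ d → d < j → evenColumn a d j ≡ + 0
evenColumn-beyond {a} {d} {j} a≤d d<j
  rewrite inRange-false {3} (ℕₚ.≤-<-trans (ℕₚ.≤-trans (ℕₚ.m∸n≤m a 1) a≤d) d<j)
        | ≢⇒≡ᵇ≡false (ℕₚ.>⇒≢ d<j) =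
  cong b2z (trans (∨-identityʳ _) (∧-zeroʳ _))

fibColumn-inside : ∀ {a d i} → 2 ≤ i → i < a → fibColumn a d i ≡ sgn (a + i) ℤ.* + F (a ∸ i)
fibColumn-inside {suc a} {d} {suc (suc _)} 2≤i i<a rewrite inRange-true 2≤i (ℕₚ.≤-pred i<a) = refl
fibColumn-inside {i = suc zero} (s≤s ()) _

fibColumn-beyond : ∀ {a d i} → 2 ≤ a → a ≤ i → fibColumn a d i ≡ δ i d
fibColumn-beyond {suc a} {d} {i@(suc (suc _))} _ a≤i rewrite inRange-false {2} a≤i = refl
fibColumn-beyond {suc zero}    {i = suc zero} (s≤s ()) _
fibColumn-beyond {suc (suc _)} {i = suc zero} _ (s≤s ())

evenColumn-two : ∀ j → evenColumn 2 2 j ≡ δ j 2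
evenColumn-two zero                = refl
evenColumn-two (suc zero)          = refl
evenColumn-two (suc (suc zero))    = refl
evenColumn-two (suc (suc (suc j))) = cong b2z (trans (∨-identityʳ _) (∧-zeroʳ (isOdd (3 + j))))

fibColumn-two : ∀ i → fibColumn 2 2 i ≡ δ i 2
fibColumn-two zero                = refl
fibColumn-two (suc zero)          = refl
fibColumn-two (suc (suc zero))    = refl
fibColumn-two (suc (suc (suc _))) = refl

oddColumn-three : ∀ j → 1 ≤ j → oddColumn 3 j ≡ δ j 1 ℤ.+ δ j 2 ℤ.+ δ j 3
oddColumn-three (suc zero)                _ = refl
oddColumn-three (suc (suc zero))          _ = refl
oddColumn-three (suc (suc (suc zero)))    _ = refl
oddColumn-three (suc (suc (suc (suc j)))) _ = cong b2z (trans (∨-identityʳ _) (∧-zeroʳ (isEven (4 + j))))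

fibColumn-three : ∀ i → δ i 1 ℤ.+ δ i 2 ℤ.+ fibColumn 3 3 i ≡ δ i 3
fibColumn-three zero                      = refl
fibColumn-three (suc zero)                = refl
fibColumn-three (suc (suc zero))          = refl
fibColumn-three (suc (suc (suc zero)))    = refl
fibColumn-three (suc (suc (suc (suc _)))) = refl

fibColumn-even : ∀ {a d i} → isEven a ≡ true →
  fibColumn a d i ≡ (if i ≡ᵇ 1 then + F (a ∸ 2)
                     else if inRange 2 (a ∸ 1) i then sgn i ℤ.* + F (a ∸ i) else δ i d)
fibColumn-even {a} {d} {i} a-even with i ≡ᵇ 1 | inRange 2 (a ∸ 1) i
... | true  | _     rewrite a-even = ℤₚ.*-identityˡ _
... | false | true  = cong (ℤ._* + F (a ∸ i)) (sgn-+-even a a-even)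
... | false | false = refl

fibColumn-odd : ∀ {a d i} → isEven a ≡ false →
  fibColumn a d i ≡ (if i ≡ᵇ 1 then - + F (a ∸ 2)
                     else if inRange 2 (a ∸ 1) i then sgn (suc i) ℤ.* + F (a ∸ i) else δ i d)
fibColumn-odd {a} {d} {i} a-odd with i ≡ᵇ 1 | inRange 2 (a ∸ 1) i
... | true  | _     rewrite a-odd = ℤₚ.-1*i≡-i _
... | false | true  = cong (ℤ._* + F (a ∸ i)) (trans (sgn-+-odd a a-odd) (sym (sgn-suc i)))
... | false | false = refl

evenColumn-move-diagonal : ∀ {a d} → 1 ≤ a → a ≤ d → ∀ j →
  evenColumn a d j ℤ.+ δ j a ≡ evenColumn a a j ℤ.+ δ j d
evenColumn-move-diagonal {suc a} {d} _ a≤d j with isOdd j ∧ inRange 3 a j in odd-inside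
... | false = ℤₚ.+-comm (δ j d) (δ j (suc a))
... | true  = cong (ℤ._+_ (+ 1)) (δ-<-both j<a a≤d)
  where
  j<a : j < suc a
  j<a = s≤s (inRange⇒≤ {3} (proj₂ (Equivalence.to (T-∧ {isOdd j}) (Equivalence.from T-≡ odd-inside))))

fibColumn-move-diagonal : ∀ {a d} → 2 ≤ a → a ≤ d → ∀ i →
  fibColumn a d i ℤ.+ δ i a ≡ fibColumn a a i ℤ.+ δ i d
fibColumn-move-diagonal {suc a} {d} 2≤a a≤d i with i ≡ᵇ 1 in i≡ᵇ1
... | true  = cong (ℤ._+_ (sgn (suc a) ℤ.* + F (suc a ∸ 2))) (δ-<-both {i} i<a a≤d)
  where
  i<a : i < suc a
  i<a = subst (_< suc a) (sym (ℕₚ.≡ᵇ⇒≡ i 1 (Equivalence.from T-≡ i≡ᵇ1))) 2≤a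
... | false with inRange 2 a i in inside
...   | true  = cong (ℤ._+_ (sgn (suc a + i) ℤ.* + F (suc a ∸ i))) (δ-<-both {i} i<a a≤d)
  where
  i<a : i < suc a
  i<a = s≤s (inRange⇒≤ {2} (Equivalence.from T-≡ inside))
...   | false = ℤₚ.+-comm (δ i d) (δ i (suc a))

data RowPosition (k : ℕ) : ℕ → Set where
  first    : RowPosition k 1
  inside   : ∀ {i} → 2 ≤ i → i < k → RowPosition k i
  diagonal : RowPosition k k
  next     : RowPosition k (1 + k)
  next₂    : RowPosition k (2 + k)
  beyond   : ∀ {i} → 2 + k < i → RowPosition k i

rowPosition : ∀ {k} i → 2 ≤ k → 1 ≤ i → RowPosition k i
rowPosition (suc zero)        _ _ = first
rowPosition {k} (suc (suc u)) _ _ with ℕₚ.<-cmp (2 + u) k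
... | tri< i<k _ _ = inside (s≤s (s≤s z≤n)) i<k
... | tri≈ _ refl _ = diagonal
... | tri> _ _ k<i with ℕₚ.≤⇒≤‴ k<i
...   | ≤‴-refl                  = next
...   | ≤‴-step ≤‴-refl           = next₂
...   | ≤‴-step (≤‴-step 2+k<‴i) = beyond (ℕₚ.≤‴⇒≤ 2+k<‴i)

oddColumn-step : ∀ {k} → 2 ≤ k → isEven k ≡ false → ∀ {j} → 1 ≤ j →
  oddColumn (2 + k) j ℤ.+ δ j k ≡ oddColumn k j ℤ.+ δ j (1 + k) ℤ.+ δ j (2 + k)
oddColumn-step {k} 2≤k k-odd {j} 1≤j with rowPosition j 2≤k 1≤j
... | first
  rewrite δ-< {1} {k} 2≤k | δ-< {1} {1 + k} (ℕₚ.m<n⇒m<1+n 2≤k) = refl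
... | inside 2≤j j<k
  rewrite oddColumn-inside {2 + k} 2≤j (ℕₚ.<-trans j<k (n<2+n k)) | oddColumn-inside 2≤j j<k
        | δ-< j<k | δ-< (ℕₚ.m<n⇒m<1+n j<k) | δ-< (ℕₚ.<-trans j<k (n<2+n k)) = sym (ℤₚ.+-identityʳ _)
... | diagonal
  rewrite oddColumn-inside {2 + k} {k} 2≤k (n<2+n k) | oddColumn-diagonal k | k-odd
        | δ-diagonal k | δ-< (ℕₚ.n<1+n k) | δ-< (n<2+n k) = refl
... | next
  rewrite oddColumn-inside {2 + k} {1 + k} (ℕₚ.m≤n⇒m≤1+n 2≤k) (ℕₚ.n<1+n (1 + k))
        | oddColumn-beyond {k} (ℕₚ.<⇒≤ 2≤k) (ℕₚ.n<1+n k) | isEven-suc k | k-odd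
        | δ-> (ℕₚ.n<1+n k) | δ-diagonal (1 + k) | δ-< (ℕₚ.n<1+n (1 + k)) = refl
... | next₂
  rewrite oddColumn-diagonal (2 + k) | oddColumn-beyond {k} (ℕₚ.<⇒≤ 2≤k) (n<2+n k)
        | δ-> (n<2+n k) | δ-> (ℕₚ.n<1+n (1 + k)) | δ-diagonal (2 + k) = refl
... | beyond 2+k<j
  rewrite oddColumn-beyond {2 + k} (s≤s z≤n) 2+k<j | oddColumn-beyond {k} (ℕₚ.<⇒≤ 2≤k) (ℕₚ.<-trans (n<2+n k) 2+k<j)
        | δ-> (ℕₚ.<-trans (n<2+n k) 2+k<j) | δ-> (ℕₚ.<-trans (ℕₚ.n<1+n (1 + k)) 2+k<j) | δ-> 2+k<j = refl

evenColumn-step : ∀ {k} → 2 ≤ k → isOdd k ≡ false → ∀ {j} → 1 ≤ j →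
  evenColumn (2 + k) (2 + k) j ℤ.+ δ j k ≡ evenColumn k k j ℤ.+ δ j (1 + k) ℤ.+ δ j (2 + k)
evenColumn-step {k} 2≤k k-even {j} 1≤j with rowPosition j 2≤k 1≤j
... | first
  rewrite δ-< {1} {k} 2≤k | δ-< {1} {1 + k} (ℕₚ.m<n⇒m<1+n 2≤k) = refl
... | inside 2≤j j<k
  rewrite evenColumn-inside {2 + k} {2 + k} 2≤j (ℕₚ.<-trans j<k (n<2+n k)) ℕₚ.≤-refl
        | evenColumn-inside 2≤j j<k ℕₚ.≤-refl
        | δ-< j<k | δ-< (ℕₚ.m<n⇒m<1+n j<k) | δ-< (ℕₚ.<-trans j<k (n<2+n k)) = sym (ℤₚ.+-identityʳ _)
... | diagonal
  rewrite evenColumn-inside {2 + k} {2 + k} 2≤k (n<2+n k) ℕₚ.≤-refl | evenColumn-diagonal k k | k-even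
        | δ-diagonal k | δ-< (ℕₚ.n<1+n k) | δ-< (n<2+n k) = refl
... | next
  rewrite evenColumn-inside {2 + k} {2 + k} (ℕₚ.m≤n⇒m≤1+n 2≤k) (ℕₚ.n<1+n (1 + k)) ℕₚ.≤-refl
        | evenColumn-beyond {k} ℕₚ.≤-refl (ℕₚ.n<1+n k) | isOdd-suc k | k-even
        | δ-> (ℕₚ.n<1+n k) | δ-diagonal (1 + k) | δ-< (ℕₚ.n<1+n (1 + k)) = refl
... | next₂
  rewrite evenColumn-diagonal (2 + k) (2 + k) | evenColumn-beyond {k} ℕₚ.≤-refl (n<2+n k)
        | δ-> (n<2+n k) | δ-> (ℕₚ.n<1+n (1 + k)) | δ-diagonal (2 + k) = refl
... | beyond 2+k<j
  rewrite evenColumn-beyond {2 + k} ℕₚ.≤-refl 2+k<j | evenColumn-beyond {k} ℕₚ.≤-refl (ℕₚ.<-trans (n<2+n k) 2+k<j)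
        | δ-> (ℕₚ.<-trans (n<2+n k) 2+k<j) | δ-> (ℕₚ.<-trans (ℕₚ.n<1+n (1 + k)) 2+k<j) | δ-> 2+k<j = refl

signed-fibonacci : ∀ σ x → σ ℤ.* + F (2 + x) ℤ.+ - σ ℤ.* + F (1 + x) ≡ σ ℤ.* + F x
signed-fibonacci σ x rewrite ℤₚ.pos-+ (F (1 + x)) (F x) = distribute σ (+ F (1 + x)) (+ F x)
  where
  distribute : ∀ σ a b → σ ℤ.* (a ℤ.+ b) ℤ.+ - σ ℤ.* a ≡ σ ℤ.* b
  distribute = solve-∀

fibColumn-step : ∀ {k} → 2 ≤ k → ∀ {i} → 1 ≤ i →
  fibColumn (2 + k) (2 + k) i ℤ.+ fibColumn (1 + k) (1 + k) i ℤ.+ δ i k ≡ δ i (2 + k) ℤ.+ fibColumn k k i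
fibColumn-step {k} 2≤k {i} 1≤i with rowPosition i 2≤k 1≤i
fibColumn-step {suc zero} (s≤s ()) _ | first
fibColumn-step {suc (suc r)} _ _ | first
  rewrite sgn-suc (2 + r) = trans (ℤₚ.+-identityʳ _) (trans (signed-fibonacci (sgn (2 + r)) r) (sym (ℤₚ.+-identityˡ _)))
... | inside 2≤i i<k
  rewrite fibColumn-inside {2 + k} {2 + k} 2≤i (ℕₚ.<-trans i<k (n<2+n k))
        | fibColumn-inside {1 + k} {1 + k} 2≤i (ℕₚ.m<n⇒m<1+n i<k)
        | fibColumn-inside {k} {k} 2≤i i<k | δ-< i<k | δ-< (ℕₚ.<-trans i<k (n<2+n k))
        | ℕₚ.+-∸-assoc 2 (ℕₚ.<⇒≤ i<k) | ℕₚ.+-∸-assoc 1 (ℕₚ.<⇒≤ i<k) | sgn-suc (k + i) =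
  trans (ℤₚ.+-identityʳ _) (trans (signed-fibonacci (sgn (k + i)) (k ∸ i)) (sym (ℤₚ.+-identityˡ _)))
... | diagonal
  rewrite fibColumn-inside {2 + k} {2 + k} 2≤k (n<2+n k) | fibColumn-inside {1 + k} {1 + k} 2≤k (ℕₚ.n<1+n k)
        | fibColumn-beyond {k} {k} 2≤k ℕₚ.≤-refl | δ-diagonal k | δ-< (n<2+n k)
        | ℕₚ.m+n∸n≡m 2 k | ℕₚ.m+n∸n≡m 1 k | sgn-suc (k + k) | sgn-double k = refl
... | next
  rewrite fibColumn-inside {2 + k} {2 + k} (ℕₚ.m≤n⇒m≤1+n 2≤k) (ℕₚ.n<1+n (1 + k))
        | fibColumn-beyond {1 + k} {1 + k} (ℕₚ.m≤n⇒m≤1+n 2≤k) ℕₚ.≤-refl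
        | fibColumn-beyond {k} {k} 2≤k (ℕₚ.n≤1+n k)
        | δ-diagonal (1 + k) | δ-> (ℕₚ.n<1+n k) | δ-< (ℕₚ.n<1+n (1 + k))
        | ℕₚ.m+n∸n≡m 1 (1 + k) | ℕₚ.+-suc k k | sgn-suc (k + k) | sgn-double k = refl
... | next₂
  rewrite fibColumn-beyond {2 + k} {2 + k} (ℕₚ.≤-trans 2≤k (ℕₚ.m≤n+m k 2)) ℕₚ.≤-refl
        | fibColumn-beyond {1 + k} {1 + k} (ℕₚ.m≤n⇒m≤1+n 2≤k) (ℕₚ.n≤1+n (1 + k))
        | fibColumn-beyond {k} {k} 2≤k (ℕₚ.<⇒≤ (n<2+n k))
        | δ-diagonal (2 + k) | δ-> (ℕₚ.n<1+n (1 + k)) | δ-> (n<2+n k) = refl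
... | beyond 2+k<i
  rewrite fibColumn-beyond {2 + k} {2 + k} (ℕₚ.≤-trans 2≤k (ℕₚ.m≤n+m k 2)) (ℕₚ.<⇒≤ 2+k<i)
        | fibColumn-beyond {1 + k} {1 + k} (ℕₚ.m≤n⇒m≤1+n 2≤k) (ℕₚ.<⇒≤ (ℕₚ.<-trans (ℕₚ.n<1+n (1 + k)) 2+k<i))
        | fibColumn-beyond {k} {k} 2≤k (ℕₚ.<⇒≤ (ℕₚ.<-trans (n<2+n k) 2+k<i))
        | δ-> 2+k<i | δ-> (ℕₚ.<-trans (ℕₚ.n<1+n (1 + k)) 2+k<i) | δ-> (ℕₚ.<-trans (n<2+n k) 2+k<i) = refl

-- Inverting a matrix column by column

dot : ℕ → (ℕ → ℤ) → (ℕ → ℤ) → ℤ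
dot m u v = Σ m (λ j → u (suc (toℕ j)) ℤ.* v (suc (toℕ j)))

dot-cong : ∀ m u {v w : ℕ → ℤ} → (∀ j → 1 ≤ j → v j ≡ w j) → dot m u v ≡ dot m u w
dot-cong m u v≡w = Σ-cong m (λ j → cong (u (suc (toℕ j)) ℤ.*_) (v≡w (suc (toℕ j)) (s≤s z≤n)))

dot-δ : ∀ m u {a} → 1 ≤ a → a ≤ m → dot m u (λ j → δ j a) ≡ u a
dot-δ (suc m) u {suc zero} _ _ = begin
  u 1 ℤ.* + 1 ℤ.+ Σ m (λ j → u (2 + toℕ j) ℤ.* + 0)
    ≡⟨ cong₂ ℤ._+_ (ℤₚ.*-identityʳ (u 1)) (Σ-zero m (λ j → ℤₚ.*-zeroʳ (u (2 + toℕ j)))) ⟩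
  u 1 ℤ.+ + 0                                          ≡⟨ ℤₚ.+-identityʳ (u 1) ⟩
  u 1                                                  ∎
  where open ≡-Reasoning
dot-δ (suc m) u {suc (suc a)} _ (s≤s a<m) = begin
  u 1 ℤ.* + 0 ℤ.+ dot m (λ j → u (suc j)) (λ j → δ j (suc a))
    ≡⟨ cong (ℤ._+ dot m (λ j → u (suc j)) (λ j → δ j (suc a))) (ℤₚ.*-zeroʳ (u 1)) ⟩
  + 0 ℤ.+ dot m (λ j → u (suc j)) (λ j → δ j (suc a))  ≡⟨ ℤₚ.+-identityˡ _ ⟩
  dot m (λ j → u (suc j)) (λ j → δ j (suc a))          ≡⟨ dot-δ m (λ j → u (suc j)) (s≤s z≤n) a<m ⟩
  u (2 + a)                                            ∎
  where open ≡-Reasoning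

dot-+-δ : ∀ m u v {a} → 1 ≤ a → a ≤ m → dot m u (λ j → v j ℤ.+ δ j a) ≡ dot m u v ℤ.+ u a
dot-+-δ m u v {a} 1≤a a≤m = begin
  dot m u (λ j → v j ℤ.+ δ j a)
    ≡⟨ Σ-cong m (λ j → ℤₚ.*-distribˡ-+ (u (suc (toℕ j))) _ _) ⟩
  Σ m (λ j → u (suc (toℕ j)) ℤ.* v (suc (toℕ j)) ℤ.+ u (suc (toℕ j)) ℤ.* δ (suc (toℕ j)) a)
    ≡⟨ Σ-distrib-+ m _ _ ⟩
  dot m u v ℤ.+ dot m u (λ j → δ j a)  ≡⟨ cong (ℤ._+_ (dot m u v)) (dot-δ m u 1≤a a≤m) ⟩
  dot m u v ℤ.+ u a                    ∎
  where open ≡-Reasoning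

-- The relations between columns are written without subtraction, each term on the side where it is added.
column-step-inverse : ∀ m (x c : ℕ → ℕ → ℤ) {k} → 1 ≤ k → 2 + k ≤ m →
  (∀ j → 1 ≤ j → c j (2 + k) ℤ.+ δ j k ≡ c j k ℤ.+ δ j (1 + k) ℤ.+ δ j (2 + k)) →
  (∀ i → 1 ≤ i → x i (2 + k) ℤ.+ x i (1 + k) ℤ.+ δ i k ≡ δ i (2 + k) ℤ.+ x i k) →
  (∀ i → 1 ≤ i → dot m (x i) (λ j → c j k) ≡ δ i k) →
  ∀ i → 1 ≤ i → dot m (x i) (λ j → c j (2 + k)) ≡ δ i (2 + k)
column-step-inverse m x c {k} 1≤k 2+k≤m c-step x-step xc≡δ i 1≤i = ∙-cancelʳ (x i k) _ _ (begin
  dot m (x i) (c-column (2 + k)) ℤ.+ x i k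
    ≡⟨ dot-+-δ m (x i) (c-column (2 + k)) 1≤k k≤m ⟨
  dot m (x i) (λ j → c j (2 + k) ℤ.+ δ j k)
    ≡⟨ dot-cong m (x i) c-step ⟩
  dot m (x i) (λ j → c j k ℤ.+ δ j (1 + k) ℤ.+ δ j (2 + k))
    ≡⟨ dot-+-δ m (x i) (λ j → c j k ℤ.+ δ j (1 + k)) (s≤s z≤n) 2+k≤m ⟩
  dot m (x i) (λ j → c j k ℤ.+ δ j (1 + k)) ℤ.+ x i (2 + k)
    ≡⟨ cong (ℤ._+ x i (2 + k)) (dot-+-δ m (x i) (c-column k) (s≤s z≤n) 1+k≤m) ⟩
  dot m (x i) (c-column k) ℤ.+ x i (1 + k) ℤ.+ x i (2 + k)
    ≡⟨ cong (λ y → y ℤ.+ x i (1 + k) ℤ.+ x i (2 + k)) (xc≡δ i 1≤i) ⟩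
  δ i k ℤ.+ x i (1 + k) ℤ.+ x i (2 + k)
    ≡⟨ reverse (δ i k) (x i (1 + k)) (x i (2 + k)) ⟩
  x i (2 + k) ℤ.+ x i (1 + k) ℤ.+ δ i k
    ≡⟨ x-step i 1≤i ⟩
  δ i (2 + k) ℤ.+ x i k
    ∎)
  where
  open ≡-Reasoning
  c-column : ℕ → ℕ → ℤ
  c-column k j = c j k
  1+k≤m : 1 + k ≤ m
  1+k≤m = ℕₚ.≤-trans (ℕₚ.n≤1+n (1 + k)) 2+k≤m
  k≤m : k ≤ m
  k≤m = ℕₚ.≤-trans (ℕₚ.n≤1+n k) 1+k≤m
  reverse : ∀ a b c → a ℤ.+ b ℤ.+ c ≡ c ℤ.+ b ℤ.+ a
  reverse = solve-∀

column-move-diagonal-inverse : ∀ m (x c : ℕ → ℕ → ℤ) {a d} → 1 ≤ a → a ≤ d → d ≤ m →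
  (∀ j → 1 ≤ j → c j d ℤ.+ δ j a ≡ c j a ℤ.+ δ j d) →
  (∀ i → x i d ℤ.+ δ i a ≡ x i a ℤ.+ δ i d) →
  (∀ i → 1 ≤ i → dot m (x i) (λ j → c j a) ≡ δ i a) →
  ∀ i → 1 ≤ i → dot m (x i) (λ j → c j d) ≡ δ i d
column-move-diagonal-inverse m x c {a} {d} 1≤a a≤d d≤m c-move x-move xc≡δ i 1≤i =
  ∙-cancelʳ (x i a) _ _ (begin
  dot m (x i) (λ j → c j d) ℤ.+ x i a
    ≡⟨ dot-+-δ m (x i) (λ j → c j d) 1≤a (ℕₚ.≤-trans a≤d d≤m) ⟨
  dot m (x i) (λ j → c j d ℤ.+ δ j a)
    ≡⟨ dot-cong m (x i) c-move ⟩
  dot m (x i) (λ j → c j a ℤ.+ δ j d)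
    ≡⟨ dot-+-δ m (x i) (λ j → c j a) (ℕₚ.≤-trans 1≤a a≤d) d≤m ⟩
  dot m (x i) (λ j → c j a) ℤ.+ x i d         ≡⟨ cong (ℤ._+ x i d) (xc≡δ i 1≤i) ⟩
  δ i a ℤ.+ x i d                             ≡⟨ ℤₚ.+-comm (δ i a) (x i d) ⟩
  x i d ℤ.+ δ i a                             ≡⟨ x-move i ⟩
  x i a ℤ.+ δ i d                             ≡⟨ ℤₚ.+-comm (x i a) (δ i d) ⟩
  δ i d ℤ.+ x i a                             ∎)
  where open ≡-Reasoning

-- C₂ and X for n = 7 + 2p

module _ (p : ℕ) where

  private
    n m : ℕ
    n = 7 + double p
    m = 6 + double p

  data LastColumn : ℕ → Set where
    penultimate : LastColumn (5 + double p)
    ultimate    : LastColumn (6 + double p)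

  -- Column 2 is even {0}: its branch in C2entry and Xentry is separate, but it has the same shape.
  data Column : ℕ → Set where
    first : Column 1
    even  : ∀ {s} → s ≤ suc p → Column (2 + double s)
    odd   : ∀ {s} → s ≤ p → Column (3 + double s)
    last  : ∀ {k} → LastColumn k → Column k

  column : ∀ {k} → 1 ≤ k → k ≤ m → Column k
  column {suc zero} _ _ = first
  column {suc (suc c)} _ k≤m with parity c
  ... | even s with ℕₚ.m≤n⇒m<n∨m≡n (double-cancel-≤ s (2 + p) (ℕₚ.m≤n⇒m≤1+n (ℕₚ.≤-pred (ℕₚ.≤-pred k≤m))))
  ...   | inj₁ s<2+p = even (ℕₚ.≤-pred s<2+p)
  ...   | inj₂ refl  = last ultimate
  column {suc (suc c)} _ k≤m | odd s
    with ℕₚ.m≤n⇒m<n∨m≡n (double-cancel-≤ s (1 + p) (ℕₚ.≤-pred (ℕₚ.≤-pred (ℕₚ.≤-pred k≤m))))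
  ...   | inj₁ s<1+p = odd (ℕₚ.≤-pred s<1+p)
  ...   | inj₂ refl  = last penultimate

  lastColumn-> : ∀ {k} → LastColumn k → 4 + double p < k
  lastColumn-> penultimate = ℕₚ.≤-refl
  lastColumn-> ultimate    = ℕₚ.n≤1+n (5 + double p)

  lastColumn-≤ : ∀ {k} → LastColumn k → k ≤ m
  lastColumn-≤ penultimate = ℕₚ.n≤1+n (5 + double p)
  lastColumn-≤ ultimate    = ℕₚ.≤-refl

  odd-column-test : ∀ {s} → s ≤ p → (isOdd (3 + double s) ∧ inRange 3 (n ∸ 4) (3 + double s)) ≡ true
  odd-column-test {s} s≤p =
    cong₂ _∧_ (isOdd-suc-double s) (inRange-true (s≤s (s≤s (s≤s z≤n))) (ℕₚ.+-monoʳ-≤ 3 (double-mono-≤ s≤p)))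

  even-column-test : ∀ {s} → s ≤ p → (isEven (4 + double s) ∧ inRange 4 (n ∸ 3) (4 + double s)) ≡ true
  even-column-test {s} s≤p =
    cong₂ _∧_ (isEven-double s) (inRange-true (s≤s (s≤s (s≤s (s≤s z≤n)))) (ℕₚ.+-monoʳ-≤ 4 (double-mono-≤ s≤p)))

  last-column-tests : ∀ {k} → LastColumn k →
    (k ≡ᵇ 1) ≡ false × (k ≡ᵇ 2) ≡ false ×
    (isOdd k ∧ inRange 3 (n ∸ 4) k) ≡ false × (isEven k ∧ inRange 4 (n ∸ 3) k) ≡ false ×
    ((k ≡ᵇ n ∸ 2) ∨ (k ≡ᵇ n ∸ 1)) ≡ true
  last-column-tests {k} c =
    ≢⇒≡ᵇ≡false (ℕₚ.>⇒≢ (ℕₚ.≤-trans (s≤s (s≤s z≤n)) 4+2p<k)) ,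
    ≢⇒≡ᵇ≡false (ℕₚ.>⇒≢ (ℕₚ.≤-trans (s≤s (s≤s (s≤s z≤n))) 4+2p<k)) ,
    ∧-inRange-above (isOdd k) (ℕₚ.<-trans (ℕₚ.n<1+n _) 4+2p<k) , ∧-inRange-above (isEven k) 4+2p<k , last-test c
    where
    4+2p<k = lastColumn-> c
    last-test : ∀ {k} → LastColumn k → ((k ≡ᵇ 5 + double p) ∨ (k ≡ᵇ 6 + double p)) ≡ true
    last-test penultimate = cong (_∨ (5 + double p ≡ᵇ 6 + double p)) (≡ᵇ-refl (5 + double p))
    last-test ultimate    =
      cong₂ _∨_ (≢⇒≡ᵇ≡false (ℕₚ.>⇒≢ (ℕₚ.n<1+n (5 + double p)))) (≡ᵇ-refl (6 + double p))

  C2entry-odd : ∀ {s} → s ≤ p → ∀ j → C2entry n j (3 + double s) ≡ oddColumn (3 + double s) j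
  C2entry-odd s≤p j rewrite odd-column-test s≤p = refl

  C2entry-even : ∀ {s} → s ≤ suc p → ∀ j → C2entry n j (2 + double s) ≡ evenColumn (2 + double s) (2 + double s) j
  C2entry-even {zero}  _   j = sym (evenColumn-two j)
  C2entry-even {suc s} s≤p j rewrite isOdd-double s | even-column-test (ℕₚ.≤-pred s≤p) = refl

  C2entry-last : ∀ {k} → LastColumn k → ∀ j → C2entry n j k ≡ evenColumn (4 + double p) k j
  C2entry-last c j with last-column-tests c
  ... | t₁ , t₂ , t₃ , t₄ , t₅ rewrite t₁ | t₂ | t₃ | t₄ | t₅ = refl

  Xentry-odd : ∀ {s} → s ≤ p → ∀ i → Xentry n i (3 + double s) ≡ fibColumn (3 + double s) (3 + double s) i
  Xentry-odd {s} s≤p i rewrite odd-column-test s≤p =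
    sym (fibColumn-odd {3 + double s} {3 + double s} {i} (isEven-suc-double s))

  Xentry-even : ∀ {s} → s ≤ suc p → ∀ i → Xentry n i (2 + double s) ≡ fibColumn (2 + double s) (2 + double s) i
  Xentry-even {zero}  _   i = sym (fibColumn-two i)
  Xentry-even {suc s} s≤p i rewrite isOdd-double s | even-column-test (ℕₚ.≤-pred s≤p) =
    sym (fibColumn-even {4 + double s} {4 + double s} {i} (isEven-double s))

  Xentry-last : ∀ {k} → LastColumn k → ∀ i → Xentry n i k ≡ fibColumn (4 + double p) k i
  Xentry-last {k} c i with last-column-tests c
  ... | t₁ , t₂ , t₃ , t₄ , t₅ rewrite t₁ | t₂ | t₃ | t₄ | t₅ =
    sym (fibColumn-even {4 + double p} {k} {i} (isEven-double p))

  C2entry-diagonal : ∀ {k} → Column k → C2entry n k k ≡ + 1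
  C2entry-diagonal first         = refl
  C2entry-diagonal (even {s} le) = trans (C2entry-even le (2 + double s)) (evenColumn-diagonal (2 + double s) (2 + double s))
  C2entry-diagonal (odd {s} le)  = trans (C2entry-odd le (3 + double s)) (oddColumn-diagonal (3 + double s))
  C2entry-diagonal (last {k} c)  = trans (C2entry-last c k) (evenColumn-diagonal (4 + double p) k)

  C2entry-below : ∀ {k} → Column k → ∀ {j} → k < j → C2entry n j k ≡ + 0
  C2entry-below first         1<j = δ-> 1<j
  C2entry-below (even le) {j} k<j = trans (C2entry-even le j) (evenColumn-beyond ℕₚ.≤-refl k<j)
  C2entry-below (odd le)  {j} k<j = trans (C2entry-odd le j) (oddColumn-beyond (s≤s z≤n) k<j)
  C2entry-below (last c)  {j} k<j = trans (C2entry-last c j) (evenColumn-beyond (ℕₚ.<⇒≤ (lastColumn-> c)) k<j)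

  C₂-unitriangular : IsUpperUnitriangular (C₂ n)
  C₂-unitriangular =
    (λ k → C2entry-diagonal (column (s≤s z≤n) (FP.toℕ<n k))) ,
    (λ j k k<j → C2entry-below (column (s≤s z≤n) (FP.toℕ<n k)) (s≤s k<j))

  -- (X n ⊗ C₂ n) i k is XC₂ (suc (toℕ i)) (suc (toℕ k)) by unfolding.
  XC₂ : ℕ → ℕ → ℤ
  XC₂ i k = dot m (Xentry n i) (λ j → C2entry n j k)

  XC₂-even-column : ∀ s → s ≤ suc p → ∀ i → 1 ≤ i → XC₂ i (2 + double s) ≡ δ i (2 + double s)
  XC₂-even-column zero    _ i _ = dot-δ m (Xentry n i) (s≤s z≤n) (s≤s (s≤s z≤n))
  XC₂-even-column (suc s) s<1+p =
    column-step-inverse m (Xentry n) (C2entry n) (s≤s z≤n) (ℕₚ.+-monoʳ-≤ 4 (double-mono-≤ s≤1+p))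
      C-step X-step (XC₂-even-column s s≤1+p)
    where
    s≤1+p = ℕₚ.m≤n⇒m≤1+n (ℕₚ.≤-pred s<1+p)
    C-step : ∀ j → 1 ≤ j → C2entry n j (4 + double s) ℤ.+ δ j (2 + double s)
                            ≡ C2entry n j (2 + double s) ℤ.+ δ j (3 + double s) ℤ.+ δ j (4 + double s)
    C-step j 1≤j rewrite C2entry-even s<1+p j | C2entry-even s≤1+p j =
      evenColumn-step (s≤s (s≤s z≤n)) (isOdd-double s) 1≤j
    X-step : ∀ i → 1 ≤ i → Xentry n i (4 + double s) ℤ.+ Xentry n i (3 + double s) ℤ.+ δ i (2 + double s)
                            ≡ δ i (4 + double s) ℤ.+ Xentry n i (2 + double s)
    X-step i 1≤i rewrite Xentry-even s<1+p i | Xentry-odd (ℕₚ.≤-pred s<1+p) i | Xentry-even s≤1+p i =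
      fibColumn-step (s≤s (s≤s z≤n)) 1≤i

  XC₂-odd-column : ∀ s → s ≤ p → ∀ i → 1 ≤ i → XC₂ i (3 + double s) ≡ δ i (3 + double s)
  XC₂-odd-column zero _ i _ = begin
    dot m (x i) (λ j → C2entry n j 3)
      ≡⟨ dot-cong m (x i) (λ j 1≤j → trans (C2entry-odd z≤n j) (oddColumn-three j 1≤j)) ⟩
    dot m (x i) (λ j → δ j 1 ℤ.+ δ j 2 ℤ.+ δ j 3)
      ≡⟨ dot-+-δ m (x i) (λ j → δ j 1 ℤ.+ δ j 2) (s≤s z≤n) (s≤s (s≤s (s≤s z≤n))) ⟩
    dot m (x i) (λ j → δ j 1 ℤ.+ δ j 2) ℤ.+ x i 3
      ≡⟨ cong (ℤ._+ x i 3) (dot-+-δ m (x i) (λ j → δ j 1) (s≤s z≤n) (s≤s (s≤s z≤n))) ⟩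
    dot m (x i) (λ j → δ j 1) ℤ.+ x i 2 ℤ.+ x i 3
      ≡⟨ cong (λ y → y ℤ.+ x i 2 ℤ.+ x i 3) (dot-δ m (x i) (s≤s z≤n) (s≤s z≤n)) ⟩
    δ i 1 ℤ.+ δ i 2 ℤ.+ x i 3
      ≡⟨ cong (ℤ._+_ (δ i 1 ℤ.+ δ i 2)) (Xentry-odd z≤n i) ⟩
    δ i 1 ℤ.+ δ i 2 ℤ.+ fibColumn 3 3 i
      ≡⟨ fibColumn-three i ⟩
    δ i 3
      ∎
    where
    open ≡-Reasoning
    x = Xentry n
  XC₂-odd-column (suc s) s<p =
    column-step-inverse m (Xentry n) (C2entry n) (s≤s z≤n)
      (ℕₚ.≤-trans (ℕₚ.+-monoʳ-≤ 3 (double-mono-≤ s<p)) (ℕₚ.m≤n+m (3 + double p) 3))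
      C-step X-step (XC₂-odd-column s s≤p)
    where
    s≤p = ℕₚ.≤-trans (ℕₚ.n≤1+n s) s<p
    C-step : ∀ j → 1 ≤ j → C2entry n j (5 + double s) ℤ.+ δ j (3 + double s)
                            ≡ C2entry n j (3 + double s) ℤ.+ δ j (4 + double s) ℤ.+ δ j (5 + double s)
    C-step j 1≤j rewrite C2entry-odd s<p j | C2entry-odd s≤p j =
      oddColumn-step (s≤s (s≤s z≤n)) (isEven-suc-double s) 1≤j
    X-step : ∀ i → 1 ≤ i → Xentry n i (5 + double s) ℤ.+ Xentry n i (4 + double s) ℤ.+ δ i (3 + double s)
                            ≡ δ i (5 + double s) ℤ.+ Xentry n i (3 + double s)
    X-step i 1≤i rewrite Xentry-odd s<p i | Xentry-even (s≤s s≤p) i | Xentry-odd s≤p i =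
      fibColumn-step (s≤s (s≤s z≤n)) 1≤i

  XC₂-last-column : ∀ {k} → LastColumn k → ∀ i → 1 ≤ i → XC₂ i k ≡ δ i k
  XC₂-last-column {k} c =
    column-move-diagonal-inverse m (Xentry n) (C2entry n) (s≤s z≤n) 4+2p≤k (lastColumn-≤ c)
      C-move X-move (XC₂-even-column (suc p) ℕₚ.≤-refl)
    where
    4+2p≤k = ℕₚ.<⇒≤ (lastColumn-> c)
    C-move : ∀ j → 1 ≤ j → C2entry n j k ℤ.+ δ j (4 + double p) ≡ C2entry n j (4 + double p) ℤ.+ δ j k
    C-move j _ rewrite C2entry-last c j | C2entry-even {suc p} ℕₚ.≤-refl j =
      evenColumn-move-diagonal (s≤s z≤n) 4+2p≤k j
    X-move : ∀ i → Xentry n i k ℤ.+ δ i (4 + double p) ≡ Xentry n i (4 + double p) ℤ.+ δ i k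
    X-move i rewrite Xentry-last c i | Xentry-even {suc p} ℕₚ.≤-refl i =
      fibColumn-move-diagonal (s≤s (s≤s z≤n)) 4+2p≤k i

  XC₂≡δ : ∀ {k} → Column k → ∀ i → 1 ≤ i → XC₂ i k ≡ δ i k
  XC₂≡δ first     i _ = dot-δ m (Xentry n i) (s≤s z≤n) (s≤s z≤n)
  XC₂≡δ (even le) = XC₂-even-column _ le
  XC₂≡δ (odd le)  = XC₂-odd-column _ le
  XC₂≡δ (last c)  = XC₂-last-column c

  X⊗C₂≡I : ∀ i k → (X n ⊗ C₂ n) i k ≡ I m i k
  X⊗C₂≡I i k =
    trans (XC₂≡δ (column (s≤s z≤n) (FP.toℕ<n k)) (suc (toℕ i)) (s≤s z≤n)) (b2z≡if (toℕ i ≡ᵇ toℕ k))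

  X-inverse-of-C₂ : IsInverseOf (X n) (C₂ n)
  X-inverse-of-C₂ = unitriangular-left-inverse⇒right-inverse {C = C₂ n} {X n} C₂-unitriangular X⊗C₂≡I , X⊗C₂≡I

2*[3+p]+1≡7+double : ∀ p → 2 * (3 + p) + 1 ≡ 7 + double p
2*[3+p]+1≡7+double p = trans (rearrange p) (cong (_+_ 7) (sym (double≡2* p)))
  where
  rearrange : ∀ p → 2 * (3 + p) + 1 ≡ 7 + 2 * p
  rearrange = ℕ-Solver.solve-∀

lemma2p2 : (n : ℕ) → 7 ≤ n → ∃ (λ m → n ≡ 2 * m + 1) → IsInverseOf (X n) (C₂ n)
lemma2p2 _ _ (suc (suc (suc p)) , refl) =
  subst (λ n → IsInverseOf (X n) (C₂ n)) (sym (2*[3+p]+1≡7+double p)) (X-inverse-of-C₂ p)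
lemma2p2 _ (s≤s ()) (zero , refl)
lemma2p2 _ (s≤s (s≤s (s≤s ()))) (suc zero , refl)
lemma2p2 _ (s≤s (s≤s (s≤s (s≤s (s≤s ()))))) (suc (suc zero) , refl)
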